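{- Let a concurrent program, an initial state $s_0$ and a safety property $\psi$ be given (setting described in the context). Consider the selective depth-first search algorithm that calls $\mathsf{Explore}(s_0)$, where $\mathsf{Explore}(s)$ is defined as follows: (1) if $s \not\models \psi$, report an error and terminate the whole search; (2) let $T := \mathsf{Persistent\_Set}(s)$; (3) for each transition $t \in T$ that is enabled at $s$, compute the successor $s \xrightarrow{t} s'$ and call $\mathsf{Explore}(s')$. This algorithm is sound: if it finishes without reporting an error, then the program is safe with respect to $\psi$, i.e. every state reachable from $s_0$ satisfies $\psi$.
   Context: A concurrent program consists of finitely many processes $P_1,\dots,P_n$. Each $P_i$ has a finite set $trans_i$ of transitions whose control-flow graph is acyclic; the sets $trans_i$ are pairwise disjoint, and $\mathcal{T}=\bigcup_i trans_i$. Variables are shared variables plus local variables of each process, including a program counter $pc_i$. A (symbolic) state $s$ consists of a global program point $\mathtt{pc}(s)=\langle pc_1,\dots,pc_n\rangle$ and a first-order constraint $[\![s]\!]$ over the program variables; $s\models\varphi$ means $[\![s]\!]$ implies $\varphi$. A state is infeasible if $[\![s]\!]$ is unsatisfiable; an infeasible state satisfies every formula. A transition $t$ of $P_i$ moves $P_i$ from local location $\ell_1$ to $\ell_2$, is guarded by a condition $\mathit{cond}$ and has an effect on the variables; $t$ is schedulable at $s$ if $\mathtt{pc}(s)[i]=\ell_1$, and enabled at $s$ if moreover $s\models \mathit{cond}$. Executing a schedulable transition $t$ from $s$ yields a state $s'$ (written $s\xrightarrow{t}s'$); if $t$ is schedulable but not enabled, $s'$ is infeasible. A state with no schedulable transitions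 is terminal. For $\theta\in\mathcal{T}^*$, $s\stackrel{\theta}{\Longrightarrow}s'$ denotes a sequence of such steps (a derivation), and $s'$ is then reachable from $s$. An (execution) trace is a sequence $\rho$ with $s_0\stackrel{\rho}{\Longrightarrow}s_f$, $s_f$ terminal. A trace $\rho$ is safe wrt $\psi$, written $\rho\models\psi$, if all its states satisfy $\psi$. For $t_1,t_2\in\mathcal{T}$, $t_1$ can de-schedule $t_2$ iff there is a state at which both are schedulable but $t_2$ is not schedulable after executing $t_1$. Trace coverage: $\rho_1\sqsupseteq_\psi\rho_2$ iff $\rho_1\models\psi$ implies $\rho_2\models\psi$. Semi-commutativity after a state: given a derivation $s_0\stackrel{\theta}{\Longrightarrow}s$ and $t_1,t_2\in\mathcal{T}$ that cannot de-schedule each other, $t_1$ semi-commutes with $t_2$ after $s$ wrt $\sqsupseteq_\psi$ iff for all $w_1,w_2\in\mathcal{T}^*$ such that $\theta w_1 t_1 t_2 w_2$ and $\theta w_1 t_2 t_1 w_2$ are execution traces, $\theta w_1 t_1 t_2 w_2\sqsupseteq_\psi \theta w_1 t_2 t_1 w_2$. Persistent set of a state: a set $T\subseteq\mathcal{T}$ of transitions schedulable at $s$ is persistent in $s$ wrt $\psi$ iff for every derivation $s\xrightarrow{t_1}s_1\xrightarrow{t_2}\cdots\xrightarrow{t_m}s_m$ with all $t_i\in\mathcal{T}\setminus T$, every transition of $T$ semi-commutes with every $t_i$ after $s$ wrt $\sqsupseteq_\psi$. $\mathsf{Persistent\_Set}(s)$ returns a set persistent in $s$ wrt $\psi$ (with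 respect to the derivation by which the search reached $s$) which, as in the paper's construction, contains a transition enabled at $s$ if one exists. -}

module Defs where

open import Data.Nat using (ℕ)
open import Data.Fin using (Fin; _≟_)
open import Data.Bool using (if_then_else_)
open import Data.List using (List; []; _∷_; _++_; [_])
open import Data.List.Membership.Propositional using (_∈_; _∉_)
open import Data.List.Relation.Unary.All using (All)
open import Data.Product using (Σ; _×_; _,_)
open import Relation.Nullary using (¬_)
open import Relation.Nullary.Decidable using (⌊_⌋)
open import Relation.Binary.PropositionalEquality using (_≡_)

data CPath {n m : ℕ} (proc : Fin m → Fin n) (src dst : Fin m → ℕ)
           (i : Fin n) : ℕ → ℕ → Set where
  here : ∀ {ℓ} → CPath proc src dst i ℓ ℓ
  next : ∀ {ℓ ℓ'} (t : Fin m) → proc t ≡ i → src t ≡ ℓ →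
         CPath proc src dst i (dst t) ℓ' → CPath proc src dst i ℓ ℓ'

-- A concurrent program.
--   * processes P_1..P_n are Fin n; transitions 𝒯 are Fin m (finite);
--     trans_i = { t | proc t ≡ i } (hence pairwise disjoint);
--   * transition t moves P_(proc t) from src t to dst t;
--   * Val: valuations of the (shared and local) data variables;
--   * a constraint / formula over the program variables is a predicate
--     on the global program point and the valuation;
--   * cond t is the guard of t, eff t its effect (a relation between the
--     valuation before and after);
--   * the control-flow graph of every process is acyclic.

GPC' : ℕ → Set
GPC' n = Fin n → ℕ

record Program : Set₁ where
  field
    n    : ℕ
    m    : ℕ
    Val  : Set
    proc : Fin m → Fin n
    src  : Fin m → ℕ
    dst  : Fin m → ℕ
    cond : Fin m → GPC' n → Val → Set
    eff  : Fin m → Val → Val → Set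
    acyclic : ∀ (t : Fin m) → ¬ CPath proc src dst (proc t) (dst t) (src t)

module _ (P : Program) where
  open Program P

  Trans : Set
  Trans = Fin m

  GPC : Set
  GPC = GPC' n

  Formula : Set₁
  Formula = GPC → Val → Set

  record State : Set₁ where
    constructor ⟨_,_⟩
    field
      pc  : GPC
      con : Val → Set
  open State public

  _⊨_ : State → Formula → Set
  s ⊨ φ = ∀ v → con s v → φ (pc s) v

  Schedulable : Trans → State → Set
  Schedulable t s = pc s (proc t) ≡ src t

  Enabled : Trans → State → Set
  Enabled t s = Schedulable t s × (s ⊨ cond t)

  Terminal : State → Set
  Terminal s = ∀ t → ¬ Schedulable t s

  -- successor state s --t--> s' : P_(proc t) moves to dst t; the constraint
  -- is the post-image under the effect if t is enabled, and is infeasible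
  -- (empty) otherwise.
  step : Trans → State → State
  step t s = ⟨ (λ j → if ⌊ j ≟ proc t ⌋ then dst t else pc s j)
             , (λ v' → (s ⊨ cond t) × Σ Val (λ v → con s v × eff t v v')) ⟩

  data Deriv : State → List Trans → State → Set₁ where
    done : ∀ {s} → Deriv s [] s
    _⟶_ : ∀ {s t θ s'} → Schedulable t s → Deriv (step t s) θ s' →
           Deriv s (t ∷ θ) s'

  AllSat : Formula → ∀ {s θ s'} → Deriv s θ s' → Set
  AllSat φ {s} done = s ⊨ φ
  AllSat φ {s} (_ ⟶ d) = (s ⊨ φ) × AllSat φ d

  IsTrace : State → List Trans → Set₁
  IsTrace s0 ρ = Σ State (λ sf → Deriv s0 ρ sf × Terminal sf)

  TraceSafe : State → Formula → List Trans → Set₁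
  TraceSafe s0 ψ ρ = ∀ sf (d : Deriv s0 ρ sf) → AllSat ψ d

  Covers : State → Formula → List Trans → List Trans → Set₁
  Covers s0 ψ ρ1 ρ2 = TraceSafe s0 ψ ρ1 → TraceSafe s0 ψ ρ2

  CanDeschedule : Trans → Trans → Set₁
  CanDeschedule t1 t2 =
    Σ State (λ s → Schedulable t1 s × Schedulable t2 s × ¬ Schedulable t2 (step t1 s))

  SemiCommutes : State → Formula → List Trans → Trans → Trans → Set₁
  SemiCommutes s0 ψ θ t1 t2 =
    ¬ CanDeschedule t1 t2 × ¬ CanDeschedule t2 t1 ×
    (∀ w1 w2 →
      IsTrace s0 (θ ++ w1 ++ t1 ∷ t2 ∷ w2) →
      IsTrace s0 (θ ++ w1 ++ t2 ∷ t1 ∷ w2) →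
      Covers s0 ψ (θ ++ w1 ++ t1 ∷ t2 ∷ w2) (θ ++ w1 ++ t2 ∷ t1 ∷ w2))

  Persistent : State → Formula → List Trans → State → List Trans → Set₁
  Persistent s0 ψ θ s T =
    (∀ t → t ∈ T → Schedulable t s) ×
    (∀ ts sm → Deriv s ts sm → All (_∉ T) ts →
      ∀ t t' → t ∈ T → t' ∈ ts → SemiCommutes s0 ψ θ t t')

  -- specification of Persistent_Set (as a function of the derivation θ
  -- by which the search reached s, and of s)
  PersistentSetSpec : State → Formula → (List Trans → State → List Trans) → Set₁
  PersistentSetSpec s0 ψ PS =
    ∀ θ s → Deriv s0 θ s →
      Persistent s0 ψ θ s (PS θ s) ×
      (Σ Trans (λ t → Enabled t s) → Σ Trans (λ t → t ∈ PS θ s × Enabled t s))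

  -- Explore(s), reached by θ, finishes without reporting an error
  data ExploreOK (s0 : State) (ψ : Formula) (PS : List Trans → State → List Trans)
       : List Trans → State → Set₁ where
    explore : ∀ {θ s} → s ⊨ ψ →
      (∀ t → t ∈ PS θ s → Enabled t s → ExploreOK s0 ψ PS (θ ++ [ t ]) (step t s)) →
      ExploreOK s0 ψ PS θ s

-- Take a trace w from an explored state s and let T be the persistent set chosen
-- at s. If w avoided T, a transition of T would stay schedulable along w (nothing
-- in w can de-schedule it), so w could not end in a terminal state. Hence
-- w = w₁ t w₂ with t ∈ T and w₁ disjoint from T; t semi-commutes with every
-- transition of w₁, so bubbling it to the front yields a trace t w₁ w₂ whose
-- safety implies that of w. If t is enabled, the search explored its successor and
-- induction applies; if not, the successor is infeasible and satisfies everything.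
-- Acyclicity of the control-flow graphs makes every derivation repeat no
-- transition, so it extends to a trace, and safety of all traces gives safety of
-- all reachable states.
module Submission where

open import Defs
open import Data.Empty using (⊥-elim)
open import Data.Fin using (Fin; _≟_)
import Data.Fin as Fin
open import Data.Fin.Properties using (any?; pigeonhole)
open import Data.List using (List; []; _∷_; _++_; [_]; length; lookup)
open import Data.List.Properties using (++-assoc)
open import Data.List.Membership.Propositional using (_∈_; _∉_)
open import Data.List.Membership.Propositional.Properties using (∈-lookup)
import Data.List.Membership.DecPropositional as DecMembership
open import Data.List.Relation.Unary.Any using (here; there)
open import Data.List.Relation.Unary.All as All using (All; []; _∷_)
open import Data.List.Relation.Unary.All.Properties using (¬Any⇒All¬)
open import Data.List.Relation.Unary.First using (first) renaming (_++_∷_ to splitAtFirst)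
open import Data.List.Relation.Unary.First.Properties using (toView)
open import Data.List.Relation.Unary.AllPairs using ([]; _∷_)
open import Data.List.Relation.Unary.Unique.Propositional using (Unique)
open import Data.Nat using (zero; suc; _≤_; _<_; s≤s)
open import Data.Nat.Properties using (≤-pred; ≮⇒≥)
import Data.Nat.Properties as ℕ
open import Data.Product using (∃; _×_; _,_; proj₁; proj₂)
open import Data.Sum using (inj₁; inj₂)
import Data.Sum as Sum
open import Function using (_∘_; id)
open import Relation.Nullary using (¬_; Dec; yes; no)
open import Relation.Nullary.Decidable using (decidable-stable; toSum)
open import Relation.Binary.PropositionalEquality
  using (_≡_; _≢_; _≗_; refl; sym; trans; cong; subst; module ≡-Reasoning)

unique⇒lookup-≢ : ∀ {a} {A : Set a} {xs : List A} → Unique xs →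
                  ∀ {i j} → i Fin.< j → lookup xs i ≢ lookup xs j
unique⇒lookup-≢ (x∉xs ∷ _) {Fin.zero} {Fin.suc j} _ = All.lookup x∉xs (∈-lookup j)
unique⇒lookup-≢ (_ ∷ uniq) {Fin.suc i} {Fin.suc j} (s≤s i<j) = unique⇒lookup-≢ uniq i<j

unique⇒length≤ : ∀ {k} {xs : List (Fin k)} → Unique xs → length xs ≤ k
unique⇒length≤ {xs = xs} uniq = ≮⇒≥ λ k<len →
  let i , j , i<j , same = pigeonhole k<len (lookup xs)
  in unique⇒lookup-≢ uniq i<j same

module _ {P : Program} where
  open Program P

  pc-step-≡ : ∀ t (x : State P) → pc (step P t x) (proc t) ≡ dst t
  pc-step-≡ t x with proc t ≟ proc t
  ... | yes _ = refl
  ... | no ≢ = ⊥-elim (≢ refl)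

  pc-step-≢ : ∀ t (x : State P) {j} → j ≢ proc t → pc (step P t x) j ≡ pc x j
  pc-step-≢ t x {j} j≢ with j ≟ proc t
  ... | yes ≡ = ⊥-elim (j≢ ≡)
  ... | no _ = refl

  step-cong-pc : ∀ t {x y : State P} → pc x ≗ pc y → pc (step P t x) ≗ pc (step P t y)
  step-cong-pc t x≗y j with j ≟ proc t
  ... | yes _ = refl
  ... | no _ = x≗y j

  step-comm-pc : ∀ {u t} (x : State P) → proc u ≢ proc t →
                 pc (step P t (step P u x)) ≗ pc (step P u (step P t x))
  step-comm-pc {u} {t} x u≢t j with j ≟ proc t | j ≟ proc u
  ... | yes j≡t | yes j≡u = ⊥-elim (u≢t (trans (sym j≡u) j≡t))
  ... | yes _ | no _ = refl
  ... | no _ | yes _ = refl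
  ... | no _ | no _ = refl

  schedulable? : ∀ t (x : State P) → Dec (Schedulable P t x)
  schedulable? t x = pc x (proc t) ℕ.≟ src t

  deriv-++ : ∀ {x y z p q} → Deriv P x p y → Deriv P y q z → Deriv P x (p ++ q) z
  deriv-++ done e = e
  deriv-++ (st ⟶ d) e = st ⟶ deriv-++ d e

  deriv-++⁻ : ∀ {x z} p {q} → Deriv P x (p ++ q) z →
              ∃ λ y → Deriv P x p y × Deriv P y q z
  deriv-++⁻ [] d = _ , done , d
  deriv-++⁻ (_ ∷ p) (st ⟶ d) =
    let y , d₁ , d₂ = deriv-++⁻ p d in y , st ⟶ d₁ , d₂

  trace-prepend : ∀ {x y p q} → Deriv P x p y → IsTrace P y q → IsTrace P x (p ++ q)
  trace-prepend d (z , e , z-terminal) = z , deriv-++ d e , z-terminal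

  trace-resp-pc : ∀ {x x' : State P} {w} → pc x ≗ pc x' → IsTrace P x w → IsTrace P x' w
  trace-resp-pc {x' = x'} x≗x' (_ , done , x-terminal) =
    x' , done , λ t st → x-terminal t (trans (x≗x' (proc t)) st)
  trace-resp-pc {x = x} {x' = x'} x≗x' (z , _⟶_ {t = t} st d , z-terminal) =
    trace-prepend (trans (sym (x≗x' (proc t))) st ⟶ done)
                  (trace-resp-pc (step-cong-pc t {x} {x'} x≗x') (z , d , z-terminal))

  trace-swap : ∀ {u t y r} → proc u ≢ proc t →
               IsTrace P y (u ∷ t ∷ r) → IsTrace P y (t ∷ u ∷ r)
  trace-swap {u} {t} {y} u≢t (z , su ⟶ (st ⟶ d) , z-terminal) =
    trace-prepend (trans (sym (pc-step-≢ u y (u≢t ∘ sym))) st ⟶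
                   (trans (pc-step-≢ t y u≢t) su ⟶ done))
                  (trace-resp-pc (step-comm-pc y u≢t) (z , d , z-terminal))

  schedulable-step : ∀ {u t} x → ¬ CanDeschedule P u t →
                     Schedulable P u x → Schedulable P t x → Schedulable P t (step P u x)
  schedulable-step {u} {t} x ¬u↝t su st =
    decidable-stable (schedulable? t (step P u x)) λ ¬st → ¬u↝t (x , su , st , ¬st)

  schedulable-deriv : ∀ {t x y w} → All (λ u → ¬ CanDeschedule P u t) w →
                      Deriv P x w y → Schedulable P t x → Schedulable P t y
  schedulable-deriv [] done st = st
  schedulable-deriv {x = x} (¬u↝t ∷ ¬w↝t) (su ⟶ d) st =
    schedulable-deriv ¬w↝t d (schedulable-step x ¬u↝t su st)

  -- Within one process, u followed by a still-schedulable t would close the cycle dst u = src u.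
  ¬deschedule⇒proc-≢ : ∀ {u t} x → ¬ CanDeschedule P u t →
                       Schedulable P u x → Schedulable P t x → proc u ≢ proc t
  ¬deschedule⇒proc-≢ {u} {t} x ¬u↝t su st u≡t =
    acyclic u (subst (CPath proc src dst (proc u) (dst u)) loop here)
    where
    open ≡-Reasoning
    loop : dst u ≡ src u
    loop = begin
      dst u                    ≡⟨ pc-step-≡ u x ⟨
      pc (step P u x) (proc u) ≡⟨ cong (pc (step P u x)) u≡t ⟩
      pc (step P u x) (proc t) ≡⟨ schedulable-step x ¬u↝t su st ⟩
      src t                    ≡⟨ st ⟨
      pc x (proc t)            ≡⟨ cong (pc x) u≡t ⟨
      pc x (proc u)            ≡⟨ su ⟩
      src u                    ∎

  cpath-to-fired : ∀ {x y w u} → Deriv P x w y → u ∈ w →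
                   ∀ {i} → proc u ≡ i → CPath proc src dst i (pc x i) (src u)
  cpath-to-fired (su ⟶ _) (here refl) refl = subst (λ ℓ → CPath proc src dst _ ℓ _) (sym su) here
  cpath-to-fired {x} (_⟶_ {t = t} st d) (there u∈w) {i} u∈i with proc t ≟ i
  ... | yes refl = next t refl (sym st)
                     (subst (λ ℓ → CPath proc src dst _ ℓ _) (pc-step-≡ t x) (cpath-to-fired d u∈w u∈i))
  ... | no t∉i = subst (λ ℓ → CPath proc src dst i ℓ _) (pc-step-≢ t x (t∉i ∘ sym))
                   (cpath-to-fired d u∈w u∈i)

  deriv-unique : ∀ {x y w} → Deriv P x w y → Unique w
  deriv-unique done = []
  deriv-unique {x} (_⟶_ {t = t} _ d) = ¬Any⇒All¬ _ refired ∷ deriv-unique d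
    where
    refired : t ∉ _
    refired t∈w = acyclic t (subst (λ ℓ → CPath proc src dst _ ℓ _) (pc-step-≡ t x)
                                   (cpath-to-fired d t∈w refl))

  extend-within : ∀ k x → (∀ {w y} → Deriv P x w y → length w < k) → ∃ (IsTrace P x)
  extend-within zero x bounded with () ← bounded done
  extend-within (suc k) x bounded with any? (λ t → schedulable? t x)
  ... | no stuck = [] , x , done , λ t st → stuck (t , st)
  ... | yes (t , st) =
    let w , trace = extend-within k (step P t x) (λ d → ≤-pred (bounded (st ⟶ d)))
    in t ∷ w , trace-prepend (st ⟶ done) trace

  trace-extension : ∀ x → ∃ (IsTrace P x)
  trace-extension x = extend-within (suc m) x (s≤s ∘ unique⇒length≤ ∘ deriv-unique)

  Feasible : State P → Set
  Feasible x = ∃ (con x)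

  feasible-step⇒enabled : ∀ {t x} → Schedulable P t x → Feasible (step P t x) → Enabled P t x
  feasible-step⇒enabled st (_ , x⊨cond , _) = st , x⊨cond

module _ {P : Program} (ψ : Formula P) where

  SafeAlong : State P → List (Trans P) → Set
  SafeAlong x [] = _⊨_ P x ψ
  SafeAlong x (t ∷ w) = _⊨_ P x ψ × SafeAlong (step P t x) w

  safeAlong-head : ∀ {x} w → SafeAlong x w → _⊨_ P x ψ
  safeAlong-head [] safe = safe
  safeAlong-head (_ ∷ _) = proj₁

  safeAlong-++⁺ : ∀ {x y p q} → Deriv P x p y → SafeAlong x p → SafeAlong y q →
                  SafeAlong x (p ++ q)
  safeAlong-++⁺ done _ safe = safe
  safeAlong-++⁺ (_ ⟶ d) (x⊨ψ , safe₁) safe₂ = x⊨ψ , safeAlong-++⁺ d safe₁ safe₂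

  safeAlong-++⁻ : ∀ {x y p q} → Deriv P x p y → SafeAlong x (p ++ q) → SafeAlong y q
  safeAlong-++⁻ done safe = safe
  safeAlong-++⁻ (_ ⟶ d) (_ , safe) = safeAlong-++⁻ d safe

  safeAlong⇒allSat : ∀ {x y w} (d : Deriv P x w y) → SafeAlong x w → AllSat P ψ d
  safeAlong⇒allSat done safe = safe
  safeAlong⇒allSat (_ ⟶ d) (x⊨ψ , safe) = x⊨ψ , safeAlong⇒allSat d safe

  allSat⇒safeAlong : ∀ {x y w} (d : Deriv P x w y) → AllSat P ψ d → SafeAlong x w
  allSat⇒safeAlong done sat = sat
  allSat⇒safeAlong (_ ⟶ d) (x⊨ψ , sat) = x⊨ψ , allSat⇒safeAlong d sat

  covers⇒safeAlong : ∀ {s0 ρ₁ ρ₂ y} → Covers P s0 ψ ρ₁ ρ₂ → Deriv P s0 ρ₂ y →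
                     SafeAlong s0 ρ₁ → SafeAlong s0 ρ₂
  covers⇒safeAlong covers d safe =
    allSat⇒safeAlong d (covers (λ _ d₁ → safeAlong⇒allSat d₁ safe) _ d)

  -- Constructive form of "an infeasible state, like all its successors, satisfies every formula".
  safeAlong-assumingFeasible : ∀ {x} w → (Feasible x → SafeAlong x w) → SafeAlong x w
  safeAlong-assumingFeasible [] safe = λ v c → safe (v , c) v c
  safeAlong-assumingFeasible (t ∷ w) safe =
    (λ v c → proj₁ (safe (v , c)) v c) ,
    safeAlong-assumingFeasible w (λ { (_ , _ , v , c , _) → proj₂ (safe (v , c)) })

module _ {P : Program} {s0 : State P} {ψ : Formula P} where
  open Program P
  open DecMembership (_≟_ {m}) using (_∈?_)

  semiCommutes⇒safeAlong-swap :
    ∀ {θ s α y t u r} → SemiCommutes P s0 ψ θ t u →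
    Deriv P s0 θ s → Deriv P s α y → IsTrace P y (t ∷ u ∷ r) → IsTrace P y (u ∷ t ∷ r) →
    SafeAlong ψ s0 (θ ++ α ++ t ∷ u ∷ r) → SafeAlong ψ s0 (θ ++ α ++ u ∷ t ∷ r)
  semiCommutes⇒safeAlong-swap {θ = θ} {α = α} {y = y} {r = r} (_ , _ , covers) dθ dα tu ut =
    covers⇒safeAlong ψ (covers α r (global tu) (global ut)) (proj₁ (proj₂ (global ut)))
    where
    global : ∀ {l} → IsTrace P y l → IsTrace P s0 (θ ++ α ++ l)
    global = trace-prepend dθ ∘ trace-prepend dα

  semiCommutes-to-front :
    ∀ {θ s α y t} w₁ {w₂} → Deriv P s0 θ s → Deriv P s α y → Schedulable P t y →
    All (SemiCommutes P s0 ψ θ t) w₁ → IsTrace P y (w₁ ++ t ∷ w₂) →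
    IsTrace P y (t ∷ w₁ ++ w₂) ×
    (SafeAlong ψ s0 (θ ++ α ++ t ∷ w₁ ++ w₂) → SafeAlong ψ s0 (θ ++ α ++ w₁ ++ t ∷ w₂))
  semiCommutes-to-front [] _ _ _ [] trace = trace , id
  semiCommutes-to-front {θ} {α = α} {y} {t} (u ∷ w₁) {w₂} dθ dα st (t⇄u ∷ t⇄w₁)
                        (z , su ⟶ d , z-terminal) =
    tur , subst (SafeAlong ψ s0) (reassoc _) ∘ later ∘
          subst (SafeAlong ψ s0) (sym (reassoc _)) ∘
          semiCommutes⇒safeAlong-swap t⇄u dθ dα tur utr
    where
    ¬u↝t = proj₁ (proj₂ t⇄u)
    moved = semiCommutes-to-front w₁ dθ (deriv-++ dα (su ⟶ done))
                                  (schedulable-step y ¬u↝t su st) t⇄w₁ (z , d , z-terminal)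
    later = proj₂ moved
    utr : IsTrace P y (u ∷ t ∷ w₁ ++ w₂)
    utr = trace-prepend (su ⟶ done) (proj₁ moved)
    tur : IsTrace P y (t ∷ u ∷ w₁ ++ w₂)
    tur = trace-swap (¬deschedule⇒proc-≢ y ¬u↝t su st) utr
    reassoc : ∀ l → θ ++ (α ++ [ u ]) ++ l ≡ θ ++ α ++ u ∷ l
    reassoc l = cong (θ ++_) (++-assoc α [ u ] l)

  persistent⇒semiCommutes : ∀ {θ s T w y t} → Persistent P s0 ψ θ s T →
                            Deriv P s w y → All (_∉ T) w → t ∈ T →
                            All (SemiCommutes P s0 ψ θ t) w
  persistent⇒semiCommutes (_ , semi) d w∩T≡∅ t∈T = All.tabulate (semi _ _ d w∩T≡∅ _ _ t∈T)

  persistent-traces-safe :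
    ∀ {θ s T t₀ w} → Deriv P s0 θ s → SafeAlong ψ s0 θ → Persistent P s0 ψ θ s T → t₀ ∈ T →
    (∀ {t r} → t ∈ T → IsTrace P s (t ∷ r) → SafeAlong ψ s (t ∷ r)) →
    IsTrace P s w → SafeAlong ψ s w
  persistent-traces-safe {θ = θ} {T = T} {t₀} {w} dθ safeθ persistent t₀∈T safe-from-T
                         trace@(_ , d , terminal)
    with first (λ u → Sum.swap (toSum (u ∈? T))) w
  ... | inj₂ w∩T≡∅ = ⊥-elim (terminal t₀ (schedulable-deriv ¬w↝t₀ d (proj₁ persistent t₀ t₀∈T)))
    where
    ¬w↝t₀ = All.map (proj₁ ∘ proj₂) (persistent⇒semiCommutes {θ = θ} persistent d w∩T≡∅ t₀∈T)
  ... | inj₁ firstInT with toView firstInT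
  ...   | splitAtFirst w₁∩T≡∅ t∈T _ =
    let dw₁ = proj₁ (proj₂ (deriv-++⁻ _ d))
        t⇄w₁ = persistent⇒semiCommutes {θ = θ} persistent dw₁ w₁∩T≡∅ t∈T
        trace' , covered = semiCommutes-to-front _ dθ done (proj₁ persistent _ t∈T) t⇄w₁ trace
    in safeAlong-++⁻ ψ dθ (covered (safeAlong-++⁺ ψ dθ safeθ (safe-from-T t∈T trace')))

  explored⇒⊨ : ∀ {PS θ s} → ExploreOK P s0 ψ PS θ s → _⊨_ P s ψ
  explored⇒⊨ (explore s⊨ψ _) = s⊨ψ

  explored-traces-safe :
    ∀ {PS θ s w} → PersistentSetSpec P s0 ψ PS → ExploreOK P s0 ψ PS θ s →
    Deriv P s0 θ s → SafeAlong ψ s0 θ → IsTrace P s w → SafeAlong ψ s w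
  explored-traces-safe {w = []} _ (explore s⊨ψ _) _ _ _ = s⊨ψ
  explored-traces-safe {PS} {θ} {s} {u ∷ w} spec (explore s⊨ψ children) dθ safeθ
                       trace@(_ , su ⟶ _ , _) =
    s⊨ψ , safeAlong-assumingFeasible ψ w λ feasible →
      let _ , t₀∈T , _ = proj₂ (spec θ s dθ) (u , feasible-step⇒enabled {t = u} {x = s} su feasible)
      in proj₂ (persistent-traces-safe dθ safeθ (proj₁ (spec θ s dθ)) t₀∈T safe-from-T trace)
    where
    safe-from-T : ∀ {t r} → t ∈ PS θ s → IsTrace P s (t ∷ r) → SafeAlong ψ s (t ∷ r)
    safe-from-T {t} {r} t∈T (z , st ⟶ d , z-terminal) =
      s⊨ψ , safeAlong-assumingFeasible ψ r λ feasible →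
        let child = children t t∈T (feasible-step⇒enabled {t = t} {x = s} st feasible)
        in explored-traces-safe spec child (deriv-++ dθ (st ⟶ done))
             (safeAlong-++⁺ ψ dθ safeθ (s⊨ψ , explored⇒⊨ child)) (z , d , z-terminal)

theorem1 : (P : Program) (s0 : State P) (ψ : Formula P)
           (PS : List (Trans P) → State P → List (Trans P)) →
           PersistentSetSpec P s0 ψ PS →
           ExploreOK P s0 ψ PS [] s0 →
           ∀ θ s → Deriv P s0 θ s → _⊨_ P s ψ
theorem1 P s0 ψ PS spec ok θ s d =
  let w , trace = trace-extension s
      safe = explored-traces-safe spec ok done (explored⇒⊨ ok) (trace-prepend d trace)
  in safeAlong-head ψ w (safeAlong-++⁻ ψ d safe)
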